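{- Let $n,m,r$ be nonnegative integers and $y$ complex. Then \[ w_{n+m}^{(r)}(y)=\sum_{k=0}^{n}\sum_{j=0}^{m}\left\{{m+r\atop j+r}\right\}_{r}\binom{n}{k}(j+r)^{n-k}(-1)^{n+m+j}(r)_{j}(y+1)^{j}\,w_{k}^{(r+j)}(-y-1). \]
   Context: For real $s\ge0$, $w_{n}^{(s)}(y)=\sum_{k=0}^{n}\left\{{n\atop k}\right\}(s)_{k}\,y^{k}$, where $\left\{{n\atop k}\right\}$ are Stirling numbers of the second kind and $(x)_{k}=x(x+1)\cdots(x+k-1)$, $(x)_0=1$. The $r$-Stirling numbers of the second kind are defined by $\frac{(e^{t}-1)^{j}e^{rt}}{j!}=\sum_{m\geq j}\left\{{m+r\atop j+r}\right\}_{r}\frac{t^{m}}{m!}$ (zero for $j>m$). Here $0^0=1$. -}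

module Defs where

open import Level using (Level)
open import Data.Nat using (ℕ; zero; suc; _+_; _*_)
open import Algebra.Bundles using (CommutativeRing)

stirling2 : ℕ → ℕ → ℕ
stirling2 zero    zero    = 1
stirling2 zero    (suc k) = 0
stirling2 (suc n) zero    = 0
stirling2 (suc n) (suc k) = suc k * stirling2 n (suc k) + stirling2 n k

rising : ℕ → ℕ → ℕ
rising x zero    = 1
rising x (suc k) = rising x k * (x + k)

-- rStirling r m j = {m+r  j+r}_r, the coefficient of t^m/m! in
-- (e^t - 1)^j e^{rt} / j!.  Writing G_j(t) for that series, one has
-- G_0 = e^{rt}, G_j(0) = 0 for j > 0, and G_j' = (j+r) G_j + G_{j-1};
-- comparing coefficients gives the recursion below (zero for j > m).
rStirling : ℕ → ℕ → ℕ → ℕ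
rStirling r zero    zero    = 1
rStirling r zero    (suc j) = 0
rStirling r (suc m) zero    = r * rStirling r m zero
rStirling r (suc m) (suc j) = (suc j + r) * rStirling r m (suc j) + rStirling r m j

module WithRing {c ℓ : Level} (R : CommutativeRing c ℓ) where
  open CommutativeRing R renaming (_+_ to _+ᴿ_; _*_ to _*ᴿ_)

  fromℕ : ℕ → Carrier
  fromℕ zero    = 0#
  fromℕ (suc n) = 1# +ᴿ fromℕ n

  -- powers x^n, with x^0 = 1 (so 0^0 = 1)
  pow : Carrier → ℕ → Carrier
  pow x zero    = 1#
  pow x (suc n) = x *ᴿ pow x n

  sumTo : ℕ → (ℕ → Carrier) → Carrier
  sumTo zero    f = f 0
  sumTo (suc n) f = sumTo n f +ᴿ f (suc n)

  w : ℕ → ℕ → Carrier → Carrier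
  w n s y = sumTo n (λ k → fromℕ (stirling2 n k * rising s k) *ᴿ pow y k)

{-# OPTIONS --safe #-}
-- The exponential generating function of n ↦ w_n^{(s)}(y) is (1 - y(eᵗ - 1))^{-s}. Differentiating it
-- gives w_{n+1}^{(s)} = s(y+1) w_n^{(s+1)} - s w_n^{(s)}, and iterating this m times against the
-- recursion of the r-Stirling numbers gives
--   w_{n+m}^{(r)}(y) = Σ_j {m+r, j+r}_r (-1)^{m+j} (r)_j (y+1)^j w_n^{(r+j)}(y).
-- Replacing t by -t in the generating function yields the reflection
--   w_n^{(s)}(y) = (-1)ⁿ Σ_k C(n,k) s^{n-k} w_k^{(s)}(-y-1),
-- and substituting it into every term gives the corollary. Without power series, the reflection is
-- proved by induction on n for the binomial transform B_a f(n) = Σ_k C(n,k) a^{n-k} f(k) with an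
-- arbitrary shift a, using B_a ∘ B_b = B_{a+b} and (y+1) w^{(b+1)} - y B_1 w^{(b+1)} = w^{(b)}, the
-- coefficient form of (1 - y(eᵗ - 1)) (1 - y(eᵗ - 1))^{-b-1} = (1 - y(eᵗ - 1))^{-b}.
module Submission where

open import Defs
open import Data.Nat using (ℕ; zero; suc; _+_; _∸_)
open import Data.Nat.Combinatorics using (_C_; nCk+nC[k+1]≡[n+1]C[k+1]; k>n⇒nCk≡0)
open import Algebra.Bundles using (CommutativeRing)

import Data.Nat as ℕ
import Data.Nat.Properties as ℕₚ
open import Data.Integer as ℤ using (ℤ; +_; -[1+_]; _⊖_; _◃_; sign; ∣_∣)
import Data.Integer.Properties as ℤₚ
open import Data.Sign as Sign using (Sign)
open import Data.Maybe using (Maybe; just; nothing)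
open import Relation.Binary.PropositionalEquality as ≡ using (_≡_)
open import Relation.Nullary using (yes; no)
open import Algebra.Solver.Ring.AlmostCommutativeRing
  using (fromCommutativeRing; _-Raw-AlmostCommutative⟶_)

stirling2-< : ∀ {n k} → n ℕ.< k → stirling2 n k ≡ 0
stirling2-< {zero}  {suc k} _ = ≡.refl
stirling2-< {suc n} {suc k} (ℕ.s≤s n<k) =
  ≡.cong₂ ℕ._+_ (≡.trans (≡.cong (suc k ℕ.*_) (stirling2-< (ℕₚ.m<n⇒m<1+n n<k))) (ℕₚ.*-zeroʳ (suc k)))
                (stirling2-< n<k)

rStirling-< : ∀ r {m j} → m ℕ.< j → rStirling r m j ≡ 0
rStirling-< r {zero}  {suc j} _ = ≡.refl
rStirling-< r {suc m} {suc j} (ℕ.s≤s m<j) =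
  ≡.cong₂ ℕ._+_ (≡.trans (≡.cong ((suc j + r) ℕ.*_) (rStirling-< r (ℕₚ.m<n⇒m<1+n m<j))) (ℕₚ.*-zeroʳ (suc j + r)))
                (rStirling-< r m<j)

rising-suc : ∀ s k → s ℕ.* rising (suc s) k ≡ rising s (suc k)
rising-suc s zero    = ≡.trans (ℕₚ.*-identityʳ s) (≡.sym (≡.trans (ℕₚ.*-identityˡ (s + 0)) (ℕₚ.+-identityʳ s)))
rising-suc s (suc k) = begin
  s ℕ.* (rising (suc s) k ℕ.* (suc s + k))  ≡⟨ ℕₚ.*-assoc s _ _ ⟨
  s ℕ.* rising (suc s) k ℕ.* (suc s + k)    ≡⟨ ≡.cong₂ ℕ._*_ (rising-suc s k) (≡.sym (ℕₚ.+-suc s k)) ⟩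
  rising s (suc k) ℕ.* (s + suc k)          ∎
  where open ≡.≡-Reasoning

module RingArithmetic {ℓ₁ ℓ₂} (R : CommutativeRing ℓ₁ ℓ₂) where
  open CommutativeRing R renaming (_+_ to _+ᴿ_) hiding (zero)
  open WithRing R
  open import Algebra.Properties.Semiring.Mult.TCOptimised semiring
    using (_×_; ×ᵤ≈×; 1+×; ×-homo-+; ×1-homo-*)
  open import Algebra.Definitions.RawMonoid +-rawMonoid using () renaming (_×_ to _×ᵤ_)
  open import Algebra.Properties.Ring ring using (-‿involutive; -0#≈0#; -‿+-comm; -1*x≈-x)
  open import Algebra.Properties.CommutativeSemigroup +-commutativeSemigroup
    using () renaming (interchange to +-interchange)
  open import Algebra.Properties.CommutativeSemigroup *-commutativeSemigroup
    using () renaming (interchange to *-interchange)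
  open import Relation.Binary.Reasoning.Setoid setoid

  fromℕ≈×1# : ∀ n → fromℕ n ≈ n × 1#
  fromℕ≈×1# n = trans (reflexive (fromℕ≡×ᵤ1# n)) (×ᵤ≈× n 1#)
    where
    fromℕ≡×ᵤ1# : ∀ n → fromℕ n ≡ n ×ᵤ 1#
    fromℕ≡×ᵤ1# zero    = ≡.refl
    fromℕ≡×ᵤ1# (suc n) = ≡.cong (1# +ᴿ_) (fromℕ≡×ᵤ1# n)

  fromℕ-+ : ∀ m n → fromℕ (m + n) ≈ fromℕ m +ᴿ fromℕ n
  fromℕ-+ m n = begin
    fromℕ (m + n)       ≈⟨ fromℕ≈×1# (m + n) ⟩
    (m + n) × 1#        ≈⟨ ×-homo-+ 1# m n ⟩
    m × 1# +ᴿ n × 1#    ≈⟨ +-cong (fromℕ≈×1# m) (fromℕ≈×1# n) ⟨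
    fromℕ m +ᴿ fromℕ n  ∎

  fromℕ-* : ∀ m n → fromℕ (m ℕ.* n) ≈ fromℕ m * fromℕ n
  fromℕ-* m n = begin
    fromℕ (m ℕ.* n)    ≈⟨ fromℕ≈×1# (m ℕ.* n) ⟩
    (m ℕ.* n) × 1#     ≈⟨ ×1-homo-* m n ⟩
    m × 1# * n × 1#    ≈⟨ *-cong (fromℕ≈×1# m) (fromℕ≈×1# n) ⟨
    fromℕ m * fromℕ n  ∎

  fromℕ-cong : ∀ {m n} → m ≡ n → fromℕ m ≈ fromℕ n
  fromℕ-cong ≡.refl = refl

  pow-cong : ∀ n {x y} → x ≈ y → pow x n ≈ pow y n
  pow-cong zero    x≈y = refl
  pow-cong (suc n) x≈y = *-cong x≈y (pow-cong n x≈y)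

  pow-+ : ∀ x m n → pow x (m + n) ≈ pow x m * pow x n
  pow-+ x zero    n = sym (*-identityˡ _)
  pow-+ x (suc m) n = trans (*-congˡ (pow-+ x m n)) (sym (*-assoc _ _ _))

  pow-suc-∸ : ∀ x {k n} → k ℕ.≤ n → pow x (suc n ∸ k) ≈ x * pow x (n ∸ k)
  pow-suc-∸ x k≤n = reflexive (≡.cong (pow x) (ℕₚ.+-∸-assoc 1 k≤n))

  -- The optimised multiple _×_ makes ⟦ + 1 ⟧ℤ reduce to 1#, as the solver's normal forms require.
  ⟦_⟧ℤ : ℤ → Carrier
  ⟦ + n ⟧ℤ      = n × 1#
  ⟦ -[1+ n ] ⟧ℤ = - (suc n × 1#)

  ⟦⊖⟧ : ∀ m n → ⟦ m ⊖ n ⟧ℤ ≈ m × 1# - n × 1#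
  ⟦⊖⟧ m zero = begin
    ⟦ m ⊖ 0 ⟧ℤ    ≡⟨ ≡.cong ⟦_⟧ℤ (ℤₚ.⊖-≥ {m} ℕ.z≤n) ⟩
    m × 1#        ≈⟨ +-identityʳ (m × 1#) ⟨
    m × 1# +ᴿ 0#  ≈⟨ +-congˡ -0#≈0# ⟨
    m × 1# - 0#   ∎
  ⟦⊖⟧ zero (suc n) = sym (+-identityˡ _)
  ⟦⊖⟧ (suc m) (suc n) = begin
    ⟦ suc m ⊖ suc n ⟧ℤ                 ≡⟨ ≡.cong ⟦_⟧ℤ (ℤₚ.[1+m]⊖[1+n]≡m⊖n m n) ⟩
    ⟦ m ⊖ n ⟧ℤ                         ≈⟨ ⟦⊖⟧ m n ⟩
    m × 1# - n × 1#                    ≈⟨ +-identityˡ _ ⟨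
    0# +ᴿ (m × 1# - n × 1#)            ≈⟨ +-congʳ (-‿inverseʳ 1#) ⟨
    (1# - 1#) +ᴿ (m × 1# - n × 1#)     ≈⟨ +-interchange 1# (- 1#) (m × 1#) (- (n × 1#)) ⟩
    (1# +ᴿ m × 1#) +ᴿ (- 1# - n × 1#)  ≈⟨ +-congˡ (-‿+-comm 1# (n × 1#)) ⟩
    (1# +ᴿ m × 1#) - (1# +ᴿ n × 1#)    ≈⟨ +-cong (1+× m 1#) (-‿cong (1+× n 1#)) ⟨
    suc m × 1# - suc n × 1#            ∎

  ⟦+⟧ : ∀ i j → ⟦ i ℤ.+ j ⟧ℤ ≈ ⟦ i ⟧ℤ +ᴿ ⟦ j ⟧ℤ
  ⟦+⟧ -[1+ m ] -[1+ n ] = begin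
    - (suc (suc (m + n)) × 1#)    ≡⟨ ≡.cong (λ k → - (suc k × 1#)) (ℕₚ.+-suc m n) ⟨
    - ((suc m + suc n) × 1#)      ≈⟨ -‿cong (×-homo-+ 1# (suc m) (suc n)) ⟩
    - (suc m × 1# +ᴿ suc n × 1#)  ≈⟨ -‿+-comm _ _ ⟨
    - (suc m × 1#) - suc n × 1#   ∎
  ⟦+⟧ -[1+ m ] (+ n)    = trans (⟦⊖⟧ n (suc m)) (+-comm _ _)
  ⟦+⟧ (+ m)    -[1+ n ] = ⟦⊖⟧ m (suc n)
  ⟦+⟧ (+ m)    (+ n)    = ×-homo-+ 1# m n

  ⟦-⟧ : ∀ i → ⟦ ℤ.- i ⟧ℤ ≈ - ⟦ i ⟧ℤ
  ⟦-⟧ -[1+ n ]    = sym (-‿involutive _)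
  ⟦-⟧ (+ zero)  = sym -0#≈0#
  ⟦-⟧ (+ suc n) = refl

  sgn : Sign → Carrier
  sgn Sign.+ = 1#
  sgn Sign.- = - 1#

  sgn-* : ∀ s t → sgn (s Sign.* t) ≈ sgn s * sgn t
  sgn-* Sign.+ t      = sym (*-identityˡ _)
  sgn-* Sign.- Sign.+ = sym (*-identityʳ _)
  sgn-* Sign.- Sign.- = sym (trans (-1*x≈-x (- 1#)) (-‿involutive 1#))

  ⟦◃⟧ : ∀ s n → ⟦ s ◃ n ⟧ℤ ≈ sgn s * n × 1#
  ⟦◃⟧ s      zero    = sym (zeroʳ _)
  ⟦◃⟧ Sign.+ (suc n) = sym (*-identityˡ _)
  ⟦◃⟧ Sign.- (suc n) = sym (-1*x≈-x _)

  ⟦*⟧ : ∀ i j → ⟦ i ℤ.* j ⟧ℤ ≈ ⟦ i ⟧ℤ * ⟦ j ⟧ℤ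
  ⟦*⟧ i j = begin
    ⟦ sign i Sign.* sign j ◃ ∣ i ∣ ℕ.* ∣ j ∣ ⟧ℤ                ≈⟨ ⟦◃⟧ (sign i Sign.* sign j) (∣ i ∣ ℕ.* ∣ j ∣) ⟩
    sgn (sign i Sign.* sign j) * (∣ i ∣ ℕ.* ∣ j ∣) × 1#        ≈⟨ *-cong (sgn-* (sign i) (sign j)) (×1-homo-* ∣ i ∣ ∣ j ∣) ⟩
    (sgn (sign i) * sgn (sign j)) * (∣ i ∣ × 1# * ∣ j ∣ × 1#)  ≈⟨ *-interchange _ _ _ _ ⟩
    (sgn (sign i) * ∣ i ∣ × 1#) * (sgn (sign j) * ∣ j ∣ × 1#)  ≈⟨ *-cong (⟦sign◃∣∣⟧ i) (⟦sign◃∣∣⟧ j) ⟩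
    ⟦ i ⟧ℤ * ⟦ j ⟧ℤ                                            ∎
    where
    ⟦sign◃∣∣⟧ : ∀ i → sgn (sign i) * ∣ i ∣ × 1# ≈ ⟦ i ⟧ℤ
    ⟦sign◃∣∣⟧ i = trans (sym (⟦◃⟧ (sign i) ∣ i ∣)) (reflexive (≡.cong ⟦_⟧ℤ (ℤₚ.◃-inverse i)))

  ⟦⟧ℤ-homomorphism : ℤ.+-*-rawRing -Raw-AlmostCommutative⟶ fromCommutativeRing R
  ⟦⟧ℤ-homomorphism = record
    { ⟦_⟧    = ⟦_⟧ℤ
    ; +-homo = ⟦+⟧
    ; *-homo = ⟦*⟧
    ; -‿homo = ⟦-⟧
    ; 0-homo = refl
    ; 1-homo = refl
    }

  _coeff≟_ : ∀ i j → Maybe (⟦ i ⟧ℤ ≈ ⟦ j ⟧ℤ)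
  i coeff≟ j with i ℤ.≟ j
  ... | yes ≡.refl = just refl
  ... | no  _      = nothing

  open import Algebra.Solver.Ring ℤ.+-*-rawRing (fromCommutativeRing R) ⟦⟧ℤ-homomorphism _coeff≟_ public

module Sums {ℓ₁ ℓ₂} (R : CommutativeRing ℓ₁ ℓ₂) where
  open CommutativeRing R renaming (_+_ to _+ᴿ_) hiding (zero)
  open WithRing R
  open RingArithmetic R using (solve; _:+_; _:-_; _:=_)
  open import Algebra.Properties.CommutativeSemigroup +-commutativeSemigroup using (interchange)
  open import Relation.Binary.Reasoning.Setoid setoid

  sumTo-cong-≤ : ∀ n {f g : ℕ → Carrier} → (∀ k → k ℕ.≤ n → f k ≈ g k) → sumTo n f ≈ sumTo n g
  sumTo-cong-≤ zero    f≈g = f≈g 0 ℕ.z≤n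
  sumTo-cong-≤ (suc n) f≈g =
    +-cong (sumTo-cong-≤ n (λ k k≤n → f≈g k (ℕₚ.m≤n⇒m≤1+n k≤n))) (f≈g (suc n) ℕₚ.≤-refl)

  sumTo-cong : ∀ n {f g : ℕ → Carrier} → (∀ k → f k ≈ g k) → sumTo n f ≈ sumTo n g
  sumTo-cong n f≈g = sumTo-cong-≤ n (λ k _ → f≈g k)

  sumTo-+ : ∀ n (f g : ℕ → Carrier) → sumTo n (λ k → f k +ᴿ g k) ≈ sumTo n f +ᴿ sumTo n g
  sumTo-+ zero    f g = refl
  sumTo-+ (suc n) f g = trans (+-congʳ (sumTo-+ n f g)) (interchange _ _ _ _)

  sumTo-sub : ∀ n (f g : ℕ → Carrier) → sumTo n (λ k → f k - g k) ≈ sumTo n f - sumTo n g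
  sumTo-sub zero    f g = refl
  sumTo-sub (suc n) f g = trans (+-congʳ (sumTo-sub n f g)) (regroup _ _ _ _)
    where
    regroup : ∀ a b c d → (a - b) +ᴿ (c - d) ≈ (a +ᴿ c) - (b +ᴿ d)
    regroup = solve 4 (λ a b c d → (a :- b) :+ (c :- d) := (a :+ c) :- (b :+ d)) refl

  sumTo-*ˡ : ∀ n a (f : ℕ → Carrier) → sumTo n (λ k → a * f k) ≈ a * sumTo n f
  sumTo-*ˡ zero    a f = refl
  sumTo-*ˡ (suc n) a f = trans (+-congʳ (sumTo-*ˡ n a f)) (sym (distribˡ _ _ _))

  sumTo-sucˡ : ∀ n (f : ℕ → Carrier) → sumTo (suc n) f ≈ f 0 +ᴿ sumTo n (λ k → f (suc k))
  sumTo-sucˡ zero    f = refl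
  sumTo-sucˡ (suc n) f = trans (+-congʳ (sumTo-sucˡ n f)) (+-assoc _ _ _)

  sumTo-dropLast : ∀ n (f : ℕ → Carrier) → f (suc n) ≈ 0# → sumTo (suc n) f ≈ sumTo n f
  sumTo-dropLast n f fₙ₊₁≈0 = trans (+-congˡ fₙ₊₁≈0) (+-identityʳ _)

  sumTo-shift : ∀ n (f : ℕ → Carrier) → f 0 ≈ 0# → f (suc n) ≈ 0# →
                sumTo n (λ k → f (suc k)) ≈ sumTo n f
  sumTo-shift n f f₀≈0 fₙ₊₁≈0 = begin
    sumTo n (λ k → f (suc k))         ≈⟨ +-identityˡ _ ⟨
    0# +ᴿ sumTo n (λ k → f (suc k))   ≈⟨ +-congʳ f₀≈0 ⟨
    f 0 +ᴿ sumTo n (λ k → f (suc k))  ≈⟨ sumTo-sucˡ n f ⟨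
    sumTo (suc n) f                   ≈⟨ sumTo-dropLast n f fₙ₊₁≈0 ⟩
    sumTo n f                         ∎

  sumTo-comm : ∀ n m (f : ℕ → ℕ → Carrier) →
               sumTo n (λ k → sumTo m (f k)) ≈ sumTo m (λ j → sumTo n (λ k → f k j))
  sumTo-comm zero    m f = refl
  sumTo-comm (suc n) m f =
    trans (+-congʳ (sumTo-comm n m f)) (sym (sumTo-+ m (λ j → sumTo n (λ k → f k j)) (f (suc n))))

module BinomialTransform {ℓ₁ ℓ₂} (R : CommutativeRing ℓ₁ ℓ₂) where
  open CommutativeRing R renaming (_+_ to _+ᴿ_) hiding (zero)
  open WithRing R
  open RingArithmetic R
  open Sums R
  open import Algebra.Properties.CommutativeSemigroup +-commutativeSemigroup using (x∙yz≈y∙xz)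
  open import Relation.Binary.Reasoning.Setoid setoid

  binomialTransform : Carrier → (ℕ → Carrier) → ℕ → Carrier
  binomialTransform a f n = sumTo n (λ k → fromℕ (n C k) * pow a (n ∸ k) * f k)

  binomialTransform-zero : ∀ a f → binomialTransform a f 0 ≈ f 0
  binomialTransform-zero a f = trans (*-congʳ (*-identityʳ _)) (trans (*-congʳ (+-identityʳ 1#)) (*-identityˡ _))

  binomialTransform-cong : ∀ a n {f g : ℕ → Carrier} → (∀ k → f k ≈ g k) →
                           binomialTransform a f n ≈ binomialTransform a g n
  binomialTransform-cong a n f≈g = sumTo-cong n (λ k → *-congˡ (f≈g k))

  binomialTransform-congˡ : ∀ n (f : ℕ → Carrier) {a b} → a ≈ b →
                            binomialTransform a f n ≈ binomialTransform b f n
  binomialTransform-congˡ n f a≈b = sumTo-cong n (λ k → *-congʳ (*-congˡ (pow-cong (n ∸ k) a≈b)))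

  binomialTransform-+ : ∀ a n (f g : ℕ → Carrier) →
    binomialTransform a (λ k → f k +ᴿ g k) n ≈ binomialTransform a f n +ᴿ binomialTransform a g n
  binomialTransform-+ a n f g = trans (sumTo-cong n (λ k → distribˡ _ _ _)) (sumTo-+ n _ _)

  binomialTransform-*ˡ : ∀ a n u (f : ℕ → Carrier) →
    binomialTransform a (λ k → u * f k) n ≈ u * binomialTransform a f n
  binomialTransform-*ˡ a n u f = trans (sumTo-cong n (λ k → x[uy]≈u[xy] _ _ _)) (sumTo-*ˡ n u _)
    where
    x[uy]≈u[xy] : ∀ x u y → x * (u * y) ≈ u * (x * y)
    x[uy]≈u[xy] = solve 3 (λ x u y → x :* (u :* y) := u :* (x :* y)) refl

  binomialTransform-linear : ∀ a n u v (f g : ℕ → Carrier) →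
    binomialTransform a (λ k → u * f k - v * g k) n ≈ u * binomialTransform a f n - v * binomialTransform a g n
  binomialTransform-linear a n u v f g = begin
    binomialTransform a (λ k → u * f k - v * g k) n
      ≈⟨ sumTo-cong n (λ k → distribute _ _ _ _ _) ⟩
    sumTo n (λ k → u * term f k - v * term g k)
      ≈⟨ sumTo-sub n _ _ ⟩
    sumTo n (λ k → u * term f k) - sumTo n (λ k → v * term g k)
      ≈⟨ +-cong (sumTo-*ˡ n u _) (-‿cong (sumTo-*ˡ n v _)) ⟩
    u * binomialTransform a f n - v * binomialTransform a g n ∎
    where
    term : (ℕ → Carrier) → ℕ → Carrier
    term h k = fromℕ (n C k) * pow a (n ∸ k) * h k
    distribute : ∀ x u f v g → x * (u * f - v * g) ≈ u * (x * f) - v * (x * g)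
    distribute = solve 5 (λ x u f v g → x :* (u :* f :- v :* g) := u :* (x :* f) :- v :* (x :* g)) refl

  binomialTransform-suc : ∀ a n (f : ℕ → Carrier) →
    binomialTransform a f (suc n) ≈ a * binomialTransform a f n +ᴿ binomialTransform a (λ k → f (suc k)) n
  binomialTransform-suc a n f = begin
    binomialTransform a f (suc n)               ≈⟨ sumTo-sucˡ n h ⟩
    h 0 +ᴿ sumTo n (λ k → h (suc k))            ≈⟨ +-congˡ (trans (sumTo-cong n h-suc) (sumTo-+ n _ _)) ⟩
    h 0 +ᴿ (B f⁺ +ᴿ sumTo n (λ k → q (suc k)))  ≈⟨ x∙yz≈y∙xz _ _ _ ⟩
    B f⁺ +ᴿ (q 0 +ᴿ sumTo n (λ k → q (suc k)))  ≈⟨ +-congˡ (sumTo-sucˡ n q) ⟨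
    B f⁺ +ᴿ sumTo (suc n) q                     ≈⟨ +-congˡ (sumTo-dropLast n q q-last) ⟩
    B f⁺ +ᴿ sumTo n q                           ≈⟨ +-congˡ (trans (sumTo-cong-≤ n q≈a*) (sumTo-*ˡ n a _)) ⟩
    B f⁺ +ᴿ a * B f                             ≈⟨ +-comm _ _ ⟩
    a * B f +ᴿ B f⁺                             ∎
    where
    B : (ℕ → Carrier) → Carrier
    B g = binomialTransform a g n
    f⁺ : ℕ → Carrier
    f⁺ k = f (suc k)
    h q : ℕ → Carrier
    h k = fromℕ (suc n C k) * pow a (suc n ∸ k) * f k
    q k = fromℕ (n C k) * pow a (suc n ∸ k) * f k
    h-suc : ∀ k → h (suc k) ≈ fromℕ (n C k) * pow a (n ∸ k) * f⁺ k +ᴿ q (suc k)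
    h-suc k = begin
      fromℕ (suc n C suc k) * pow a (n ∸ k) * f⁺ k
        ≡⟨ ≡.cong (λ m → fromℕ m * pow a (n ∸ k) * f⁺ k) (nCk+nC[k+1]≡[n+1]C[k+1] n k) ⟨
      fromℕ (n C k + n C suc k) * pow a (n ∸ k) * f⁺ k
        ≈⟨ *-congʳ (*-congʳ (fromℕ-+ (n C k) (n C suc k))) ⟩
      (fromℕ (n C k) +ᴿ fromℕ (n C suc k)) * pow a (n ∸ k) * f⁺ k
        ≈⟨ trans (*-congʳ (distribʳ _ _ _)) (distribʳ _ _ _) ⟩
      fromℕ (n C k) * pow a (n ∸ k) * f⁺ k +ᴿ q (suc k) ∎
    q-last : q (suc n) ≈ 0#
    q-last = begin
      fromℕ (n C suc n) * pow a (n ∸ n) * f (suc n)  ≡⟨ ≡.cong (λ m → fromℕ m * pow a (n ∸ n) * f (suc n)) (k>n⇒nCk≡0 (ℕₚ.n<1+n n)) ⟩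
      0# * pow a (n ∸ n) * f (suc n)                 ≈⟨ trans (*-congʳ (zeroˡ _)) (zeroˡ _) ⟩
      0#                                             ∎
    q≈a* : ∀ k → k ℕ.≤ n → q k ≈ a * (fromℕ (n C k) * pow a (n ∸ k) * f k)
    q≈a* k k≤n = trans (*-congʳ (*-congˡ (pow-suc-∸ a k≤n))) (reorder _ _ _ _)
      where
      reorder : ∀ b a p x → b * (a * p) * x ≈ a * (b * p * x)
      reorder = solve 4 (λ b a p x → b :* (a :* p) :* x := a :* (b :* p :* x)) refl

  binomialTransform-compose : ∀ n a b (f : ℕ → Carrier) →
    binomialTransform a (binomialTransform b f) n ≈ binomialTransform (a +ᴿ b) f n
  binomialTransform-compose zero a b f =
    trans (binomialTransform-zero a (binomialTransform b f))
          (trans (binomialTransform-zero b f) (sym (binomialTransform-zero (a +ᴿ b) f)))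
  binomialTransform-compose (suc n) a b f = begin
    Bᵃ (Bᵇ f) (suc n)                                      ≈⟨ binomialTransform-suc a n (Bᵇ f) ⟩
    a * Bᵃ (Bᵇ f) n +ᴿ Bᵃ (λ k → Bᵇ f (suc k)) n           ≈⟨ +-congˡ (binomialTransform-cong a n (λ k → binomialTransform-suc b k f)) ⟩
    a * Bᵃ (Bᵇ f) n +ᴿ Bᵃ (λ k → b * Bᵇ f k +ᴿ Bᵇ f⁺ k) n  ≈⟨ +-congˡ (trans (binomialTransform-+ a n _ _) (+-congʳ (binomialTransform-*ˡ a n b _))) ⟩
    a * Bᵃ (Bᵇ f) n +ᴿ (b * Bᵃ (Bᵇ f) n +ᴿ Bᵃ (Bᵇ f⁺) n)   ≈⟨ +-cong (*-congˡ IH) (+-cong (*-congˡ IH) (binomialTransform-compose n a b f⁺)) ⟩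
    a * X +ᴿ (b * X +ᴿ Bᵃ⁺ᵇ f⁺)                            ≈⟨ trans (sym (+-assoc _ _ _)) (+-congʳ (sym (distribʳ _ _ _))) ⟩
    (a +ᴿ b) * X +ᴿ Bᵃ⁺ᵇ f⁺                                ≈⟨ binomialTransform-suc (a +ᴿ b) n f ⟨
    binomialTransform (a +ᴿ b) f (suc n)                   ∎
    where
    Bᵃ Bᵇ : (ℕ → Carrier) → ℕ → Carrier
    Bᵃ = binomialTransform a
    Bᵇ = binomialTransform b
    Bᵃ⁺ᵇ : (ℕ → Carrier) → Carrier
    Bᵃ⁺ᵇ g = binomialTransform (a +ᴿ b) g n
    f⁺ : ℕ → Carrier
    f⁺ k = f (suc k)
    X : Carrier
    X = binomialTransform (a +ᴿ b) f n
    IH : Bᵃ (Bᵇ f) n ≈ X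
    IH = binomialTransform-compose n a b f

  binomialTransform-0# : ∀ n (f : ℕ → Carrier) → binomialTransform 0# f n ≈ f n
  binomialTransform-0# zero    f = binomialTransform-zero 0# f
  binomialTransform-0# (suc n) f = begin
    binomialTransform 0# f (suc n)                                             ≈⟨ binomialTransform-suc 0# n f ⟩
    0# * binomialTransform 0# f n +ᴿ binomialTransform 0# (λ k → f (suc k)) n  ≈⟨ +-cong (zeroˡ _) (binomialTransform-0# n _) ⟩
    0# +ᴿ f (suc n)                                                            ≈⟨ +-identityˡ _ ⟩
    f (suc n)                                                                  ∎

module StirlingPolynomials {ℓ₁ ℓ₂} (R : CommutativeRing ℓ₁ ℓ₂) where
  open CommutativeRing R renaming (_+_ to _+ᴿ_) hiding (zero)
  open WithRing R
  open RingArithmetic R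
  open Sums R
  open BinomialTransform R
  open import Relation.Binary.Reasoning.Setoid setoid

  wSeq : ℕ → Carrier → ℕ → Carrier
  wSeq s y n = w n s y

  w-zero : ∀ s y → w 0 s y ≈ 1#
  w-zero s y = trans (*-identityʳ _) (+-identityʳ 1#)

  rising-difference : ∀ S s k y →
    fromℕ s * (y +ᴿ 1#) * (fromℕ (S ℕ.* rising (suc s) k) * pow y k) - fromℕ s * (fromℕ (S ℕ.* rising s k) * pow y k)
      ≈ fromℕ S * fromℕ (rising s (suc k)) * pow y (suc k) +ᴿ fromℕ k * fromℕ S * fromℕ (rising s k) * pow y k
  rising-difference S s k y = begin
    fromℕ s * (y +ᴿ 1#) * (fromℕ (S ℕ.* rising (suc s) k) * Y) - fromℕ s * (fromℕ (S ℕ.* rising s k) * Y)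
      ≈⟨ +-cong (*-congˡ (*-congʳ (fromℕ-* S (rising (suc s) k)))) (-‿cong (*-congˡ (*-congʳ (fromℕ-* S (rising s k))))) ⟩
    fromℕ s * (y +ᴿ 1#) * (σ * ρ⁺ * Y) - fromℕ s * (σ * ρ * Y)
      ≈⟨ expand (fromℕ s) y σ ρ⁺ ρ Y ⟩
    σ * (fromℕ s * ρ⁺) * (y * Y) +ᴿ (σ * (fromℕ s * ρ⁺) * Y - fromℕ s * σ * ρ * Y)
      ≈⟨ +-cong (*-congʳ (*-congˡ shift)) (+-congʳ (*-congʳ (*-congˡ (trans shift unfold)))) ⟩
    σ * ρ₁ * (y * Y) +ᴿ (σ * (ρ * (fromℕ s +ᴿ fromℕ k)) * Y - fromℕ s * σ * ρ * Y)
      ≈⟨ +-congˡ (collect σ ρ (fromℕ s) (fromℕ k) Y) ⟩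
    σ * ρ₁ * (y * Y) +ᴿ fromℕ k * σ * ρ * Y ∎
    where
    σ ρ ρ⁺ ρ₁ Y : Carrier
    σ  = fromℕ S
    ρ  = fromℕ (rising s k)
    ρ⁺ = fromℕ (rising (suc s) k)
    ρ₁ = fromℕ (rising s (suc k))
    Y  = pow y k
    shift : fromℕ s * ρ⁺ ≈ ρ₁
    shift = trans (sym (fromℕ-* s (rising (suc s) k))) (fromℕ-cong (rising-suc s k))
    unfold : ρ₁ ≈ ρ * (fromℕ s +ᴿ fromℕ k)
    unfold = trans (fromℕ-* (rising s k) (s + k)) (*-congˡ (fromℕ-+ s k))
    expand : ∀ s y σ ρ⁺ ρ Y → s * (y +ᴿ 1#) * (σ * ρ⁺ * Y) - s * (σ * ρ * Y)
                            ≈ σ * (s * ρ⁺) * (y * Y) +ᴿ (σ * (s * ρ⁺) * Y - s * σ * ρ * Y)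
    expand = solve 6 (λ s y σ ρ⁺ ρ Y → s :* (y :+ con (+ 1)) :* (σ :* ρ⁺ :* Y) :- s :* (σ :* ρ :* Y)
                                    := σ :* (s :* ρ⁺) :* (y :* Y) :+ (σ :* (s :* ρ⁺) :* Y :- s :* σ :* ρ :* Y)) refl
    collect : ∀ σ ρ s k Y → σ * (ρ * (s +ᴿ k)) * Y - s * σ * ρ * Y ≈ k * σ * ρ * Y
    collect = solve 5 (λ σ ρ s k Y → σ :* (ρ :* (s :+ k)) :* Y :- s :* σ :* ρ :* Y := k :* σ :* ρ :* Y) refl

  w-suc-stirling2 : ∀ n s y → w (suc n) s y ≈ sumTo n (λ k →
    fromℕ (stirling2 n k) * fromℕ (rising s (suc k)) * pow y (suc k) +ᴿ fromℕ k * fromℕ (stirling2 n k) * fromℕ (rising s k) * pow y k)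
  w-suc-stirling2 n s y = begin
    w (suc n) s y                                   ≈⟨ sumTo-sucˡ n t ⟩
    t 0 +ᴿ sumTo n (λ k → t (suc k))                ≈⟨ +-cong (zeroˡ _) (trans (sumTo-cong n t-suc) (sumTo-+ n _ _)) ⟩
    0# +ᴿ (sumTo n (λ k → D (suc k)) +ᴿ sumTo n E)  ≈⟨ +-identityˡ _ ⟩
    sumTo n (λ k → D (suc k)) +ᴿ sumTo n E          ≈⟨ +-congʳ (sumTo-shift n D D₀≈0 Dₙ₊₁≈0) ⟩
    sumTo n D +ᴿ sumTo n E                          ≈⟨ trans (sumTo-+ n E D) (+-comm _ _) ⟨
    sumTo n (λ k → E k +ᴿ D k)                      ∎
    where
    σ ρ t D E : ℕ → Carrier
    σ k = fromℕ (stirling2 n k)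
    ρ k = fromℕ (rising s k)
    t k = fromℕ (stirling2 (suc n) k ℕ.* rising s k) * pow y k
    D k = fromℕ k * σ k * ρ k * pow y k
    E k = σ k * ρ (suc k) * pow y (suc k)

    t-suc : ∀ k → t (suc k) ≈ D (suc k) +ᴿ E k
    t-suc k = begin
      t (suc k)
        ≈⟨ *-congʳ (trans (fromℕ-* (kS + stirling2 n k) (rising s (suc k)))
                          (*-congʳ (trans (fromℕ-+ kS (stirling2 n k)) (+-congʳ (fromℕ-* (suc k) (stirling2 n (suc k))))))) ⟩
      (fromℕ (suc k) * σ (suc k) +ᴿ σ k) * ρ (suc k) * pow y (suc k)
        ≈⟨ trans (*-congʳ (distribʳ _ _ _)) (distribʳ _ _ _) ⟩
      D (suc k) +ᴿ E k ∎
      where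
      kS : ℕ
      kS = suc k ℕ.* stirling2 n (suc k)

    D₀≈0 : D 0 ≈ 0#
    D₀≈0 = solve 3 (λ x y z → con (+ 0) :* x :* y :* z := con (+ 0)) refl (σ 0) (ρ 0) (pow y 0)

    Dₙ₊₁≈0 : D (suc n) ≈ 0#
    Dₙ₊₁≈0 = trans (*-congʳ (*-congʳ (*-congˡ (fromℕ-cong (stirling2-< (ℕₚ.n<1+n n))))))
                   (solve 3 (λ x y z → x :* con (+ 0) :* y :* z := con (+ 0)) refl _ _ _)

  w-suc : ∀ n s y → w (suc n) s y ≈ fromℕ s * (y +ᴿ 1#) * w n (suc s) y - fromℕ s * w n s y
  w-suc n s y = begin
    w (suc n) s y
      ≈⟨ w-suc-stirling2 n s y ⟩
    sumTo n (λ k → fromℕ (stirling2 n k) * fromℕ (rising s (suc k)) * pow y (suc k)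
                     +ᴿ fromℕ k * fromℕ (stirling2 n k) * fromℕ (rising s k) * pow y k)
      ≈⟨ sumTo-cong n (λ k → rising-difference (stirling2 n k) s k y) ⟨
    sumTo n (λ k → fromℕ s * (y +ᴿ 1#) * u (suc s) k - fromℕ s * u s k)
      ≈⟨ sumTo-sub n _ _ ⟩
    sumTo n (λ k → fromℕ s * (y +ᴿ 1#) * u (suc s) k) - sumTo n (λ k → fromℕ s * u s k)
      ≈⟨ +-cong (sumTo-*ˡ n _ (u (suc s))) (-‿cong (sumTo-*ˡ n _ (u s))) ⟩
    fromℕ s * (y +ᴿ 1#) * w n (suc s) y - fromℕ s * w n s y ∎
    where
    u : ℕ → ℕ → Carrier
    u s k = fromℕ (stirling2 n k ℕ.* rising s k) * pow y k

  binomialTransform-w-suc : ∀ a n s y →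
    binomialTransform a (wSeq s y) (suc n)
      ≈ (a - fromℕ s) * binomialTransform a (wSeq s y) n +ᴿ fromℕ s * (y +ᴿ 1#) * binomialTransform a (wSeq (suc s) y) n
  binomialTransform-w-suc a n s y = begin
    binomialTransform a (wSeq s y) (suc n)
      ≈⟨ binomialTransform-suc a n (wSeq s y) ⟩
    a * X +ᴿ binomialTransform a (λ k → w (suc k) s y) n
      ≈⟨ +-congˡ (trans (binomialTransform-cong a n (λ k → w-suc k s y)) (binomialTransform-linear a n _ _ _ _)) ⟩
    a * X +ᴿ (fromℕ s * (y +ᴿ 1#) * Y - fromℕ s * X)
      ≈⟨ regroup a X (fromℕ s) (y +ᴿ 1#) Y ⟩
    (a - fromℕ s) * X +ᴿ fromℕ s * (y +ᴿ 1#) * Y ∎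
    where
    X Y : Carrier
    X = binomialTransform a (wSeq s y) n
    Y = binomialTransform a (wSeq (suc s) y) n
    regroup : ∀ a X s y₁ Y → a * X +ᴿ (s * y₁ * Y - s * X) ≈ (a - s) * X +ᴿ s * y₁ * Y
    regroup = solve 5 (λ a X s y₁ Y → a :* X :+ (s :* y₁ :* Y :- s :* X) := (a :- s) :* X :+ s :* y₁ :* Y) refl

  w-lowerParameter : ∀ y n b →
    (y +ᴿ 1#) * w n (suc b) y - y * binomialTransform 1# (wSeq (suc b) y) n ≈ w n b y
  w-lowerParameter y zero b = begin
    (y +ᴿ 1#) * w 0 (suc b) y - y * binomialTransform 1# (wSeq (suc b) y) 0
      ≈⟨ +-cong (*-congˡ (w-zero (suc b) y))
                (-‿cong (*-congˡ (trans (binomialTransform-zero 1# (wSeq (suc b) y)) (w-zero (suc b) y)))) ⟩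
    (y +ᴿ 1#) * 1# - y * 1#  ≈⟨ cancel y ⟩
    1#                       ≈⟨ w-zero b y ⟨
    w 0 b y                  ∎
    where
    cancel : ∀ y → (y +ᴿ 1#) * 1# - y * 1# ≈ 1#
    cancel = solve 1 (λ y → (y :+ con (+ 1)) :* con (+ 1) :- y :* con (+ 1) := con (+ 1)) refl
  w-lowerParameter y (suc n) b = begin
    y₁ * w (suc n) (suc b) y - y * binomialTransform 1# (wSeq (suc b) y) (suc n)
      ≈⟨ +-cong (*-congˡ (w-suc n (suc b) y)) (-‿cong (*-congˡ (binomialTransform-w-suc 1# n (suc b) y))) ⟩
    y₁ * ((1# +ᴿ β) * y₁ * P - (1# +ᴿ β) * Q) - y * ((1# - (1# +ᴿ β)) * U +ᴿ (1# +ᴿ β) * y₁ * V)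
      ≈⟨ expand β y y₁ P Q U V ⟩
    (1# +ᴿ β) * y₁ * (y₁ * P - y * V) - (1# +ᴿ β) * y₁ * Q +ᴿ β * (y * U)
      ≈⟨ +-congʳ (+-congʳ (*-congˡ (w-lowerParameter y n (suc b)))) ⟩
    (1# +ᴿ β) * y₁ * Q - (1# +ᴿ β) * y₁ * Q +ᴿ β * (y * U)
      ≈⟨ cancel β y y₁ Q U ⟩
    β * y₁ * Q - β * (y₁ * Q - y * U)
      ≈⟨ +-congˡ (-‿cong (*-congˡ (w-lowerParameter y n b))) ⟩
    β * y₁ * Q - β * w n b y
      ≈⟨ w-suc n b y ⟨
    w (suc n) b y ∎
    where
    y₁ β P Q U V : Carrier
    y₁ = y +ᴿ 1#
    β  = fromℕ b
    P  = w n (suc (suc b)) y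
    Q  = w n (suc b) y
    U  = binomialTransform 1# (wSeq (suc b) y) n
    V  = binomialTransform 1# (wSeq (suc (suc b)) y) n
    expand : ∀ β y y₁ P Q U V →
      y₁ * ((1# +ᴿ β) * y₁ * P - (1# +ᴿ β) * Q) - y * ((1# - (1# +ᴿ β)) * U +ᴿ (1# +ᴿ β) * y₁ * V)
        ≈ (1# +ᴿ β) * y₁ * (y₁ * P - y * V) - (1# +ᴿ β) * y₁ * Q +ᴿ β * (y * U)
    expand = solve 7 (λ β y y₁ P Q U V →
      y₁ :* ((con (+ 1) :+ β) :* y₁ :* P :- (con (+ 1) :+ β) :* Q) :- y :* ((con (+ 1) :- (con (+ 1) :+ β)) :* U :+ (con (+ 1) :+ β) :* y₁ :* V)
        := (con (+ 1) :+ β) :* y₁ :* (y₁ :* P :- y :* V) :- (con (+ 1) :+ β) :* y₁ :* Q :+ β :* (y :* U)) refl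
    cancel : ∀ β y y₁ Q U → (1# +ᴿ β) * y₁ * Q - (1# +ᴿ β) * y₁ * Q +ᴿ β * (y * U) ≈ β * y₁ * Q - β * (y₁ * Q - y * U)
    cancel = solve 5 (λ β y y₁ Q U →
      (con (+ 1) :+ β) :* y₁ :* Q :- (con (+ 1) :+ β) :* y₁ :* Q :+ β :* (y :* U) := β :* y₁ :* Q :- β :* (y₁ :* Q :- y :* U)) refl

  binomialTransform-w-lowerParameter : ∀ c n b y →
    (y +ᴿ 1#) * binomialTransform c (wSeq (suc b) y) n - y * binomialTransform c (binomialTransform 1# (wSeq (suc b) y)) n
      ≈ binomialTransform c (wSeq b y) n
  binomialTransform-w-lowerParameter c n b y = begin
    (y +ᴿ 1#) * binomialTransform c (wSeq (suc b) y) n - y * binomialTransform c (binomialTransform 1# (wSeq (suc b) y)) n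
      ≈⟨ binomialTransform-linear c n (y +ᴿ 1#) y _ _ ⟨
    binomialTransform c (λ k → (y +ᴿ 1#) * w k (suc b) y - y * binomialTransform 1# (wSeq (suc b) y) k) n
      ≈⟨ binomialTransform-cong c n (λ k → w-lowerParameter y k b) ⟩
    binomialTransform c (wSeq b y) n ∎

  binomialTransform-w-reflection : ∀ y n b a →
    pow (- 1#) n * binomialTransform a (wSeq b (- y - 1#)) n ≈ binomialTransform (fromℕ b - a) (wSeq b y) n
  binomialTransform-w-reflection y zero b a = begin
    1# * binomialTransform a (wSeq b (- y - 1#)) 0  ≈⟨ *-identityˡ _ ⟩
    binomialTransform a (wSeq b (- y - 1#)) 0       ≈⟨ binomialTransform-zero a (wSeq b (- y - 1#)) ⟩
    w 0 b (- y - 1#)                                ≈⟨ trans (w-zero b (- y - 1#)) (sym (w-zero b y)) ⟩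
    w 0 b y                                         ≈⟨ binomialTransform-zero (fromℕ b - a) (wSeq b y) ⟨
    binomialTransform (fromℕ b - a) (wSeq b y) 0    ∎
  binomialTransform-w-reflection y (suc n) b a = begin
    - 1# * σ * binomialTransform a (wSeq b z) (suc n)
      ≈⟨ *-cong (-1*x≈-x σ) (binomialTransform-w-suc a n b z) ⟩
    - σ * ((a - β) * G +ᴿ β * (z +ᴿ 1#) * G′)
      ≈⟨ distribute σ a β G (z +ᴿ 1#) G′ ⟩
    (β - a) * (σ * G) - β * (z +ᴿ 1#) * (σ * G′)
      ≈⟨ +-cong (*-congˡ (binomialTransform-w-reflection y n b a))
                (-‿cong (*-cong (*-congˡ z+1≈-y) σG′≈Z)) ⟩
    c * X - β * (- y) * Z
      ≈⟨ +-congʳ (*-congˡ (binomialTransform-w-lowerParameter c n b y)) ⟨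
    c * ((y +ᴿ 1#) * Y - y * Z) - β * (- y) * Z
      ≈⟨ regroup c β y (y +ᴿ 1#) Y Z ⟩
    (c - β) * ((y +ᴿ 1#) * Y - y * Z) +ᴿ β * (y +ᴿ 1#) * Y
      ≈⟨ +-congʳ (*-congˡ (binomialTransform-w-lowerParameter c n b y)) ⟩
    (c - β) * X +ᴿ β * (y +ᴿ 1#) * Y
      ≈⟨ binomialTransform-w-suc c n b y ⟨
    binomialTransform c (wSeq b y) (suc n) ∎
    where
    open import Algebra.Properties.Ring ring using (-1*x≈-x)
    z σ β c G G′ X Y Z : Carrier
    z  = - y - 1#
    σ  = pow (- 1#) n
    β  = fromℕ b
    c  = β - a
    G  = binomialTransform a (wSeq b z) n
    G′ = binomialTransform a (wSeq (suc b) z) n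
    X  = binomialTransform c (wSeq b y) n
    Y  = binomialTransform c (wSeq (suc b) y) n
    Z  = binomialTransform c (binomialTransform 1# (wSeq (suc b) y)) n

    z+1≈-y : z +ᴿ 1# ≈ - y
    z+1≈-y = solve 1 (λ y → :- y :- con (+ 1) :+ con (+ 1) := :- y) refl y

    σG′≈Z : σ * G′ ≈ Z
    σG′≈Z = begin
      σ * G′                                              ≈⟨ binomialTransform-w-reflection y n (suc b) a ⟩
      binomialTransform (1# +ᴿ β - a) (wSeq (suc b) y) n  ≈⟨ binomialTransform-congˡ n _ (shift β a) ⟩
      binomialTransform (c +ᴿ 1#) (wSeq (suc b) y) n      ≈⟨ binomialTransform-compose n c 1# _ ⟨
      Z                                                   ∎
      where
      shift : ∀ β a → 1# +ᴿ β - a ≈ β - a +ᴿ 1#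
      shift = solve 2 (λ β a → con (+ 1) :+ β :- a := β :- a :+ con (+ 1)) refl

    distribute : ∀ σ a β G z₁ G′ → - σ * ((a - β) * G +ᴿ β * z₁ * G′) ≈ (β - a) * (σ * G) - β * z₁ * (σ * G′)
    distribute = solve 6 (λ σ a β G z₁ G′ →
      :- σ :* ((a :- β) :* G :+ β :* z₁ :* G′) := (β :- a) :* (σ :* G) :- β :* z₁ :* (σ :* G′)) refl
    regroup : ∀ c β y y₁ Y Z → c * (y₁ * Y - y * Z) - β * (- y) * Z ≈ (c - β) * (y₁ * Y - y * Z) +ᴿ β * y₁ * Y
    regroup = solve 6 (λ c β y y₁ Y Z →
      c :* (y₁ :* Y :- y :* Z) :- β :* (:- y) :* Z := (c :- β) :* (y₁ :* Y :- y :* Z) :+ β :* y₁ :* Y) refl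

  w-reflection : ∀ y n b → pow (- 1#) n * binomialTransform (fromℕ b) (wSeq b (- y - 1#)) n ≈ w n b y
  w-reflection y n b = begin
    pow (- 1#) n * binomialTransform (fromℕ b) (wSeq b (- y - 1#)) n  ≈⟨ binomialTransform-w-reflection y n b (fromℕ b) ⟩
    binomialTransform (fromℕ b - fromℕ b) (wSeq b y) n                ≈⟨ binomialTransform-congˡ n (wSeq b y) (-‿inverseʳ (fromℕ b)) ⟩
    binomialTransform 0# (wSeq b y) n                                 ≈⟨ binomialTransform-0# n (wSeq b y) ⟩
    w n b y                                                           ∎

  expansionCoeff : ℕ → Carrier → ℕ → ℕ → Carrier
  expansionCoeff r y m j = fromℕ (rStirling r m j) * pow (- 1#) (m + j) * fromℕ (rising r j) * pow (y +ᴿ 1#) j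

  expansionCoeff-suc-zero : ∀ r y m → expansionCoeff r y (suc m) 0 ≈ - (expansionCoeff r y m 0 * fromℕ (r + 0))
  expansionCoeff-suc-zero r y m = begin
    fromℕ (r ℕ.* S) * (- 1# * s) * e * 1#       ≈⟨ *-congʳ (*-congʳ (*-congʳ (fromℕ-* r S))) ⟩
    fromℕ r * fromℕ S * (- 1# * s) * e * 1#     ≈⟨ reorder (fromℕ r) (fromℕ S) s e ⟩
    - (fromℕ S * s * e * 1# * fromℕ r)          ≈⟨ -‿cong (*-congˡ (fromℕ-cong (ℕₚ.+-identityʳ r))) ⟨
    - (expansionCoeff r y m 0 * fromℕ (r + 0))  ∎
    where
    S : ℕ
    S = rStirling r m 0
    s e : Carrier
    s = pow (- 1#) (m + 0)
    e = fromℕ 1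
    reorder : ∀ ρ S s e → ρ * S * (- 1# * s) * e * 1# ≈ - (S * s * e * 1# * ρ)
    reorder = solve 4 (λ ρ S s e →
      ρ :* S :* (:- con (+ 1) :* s) :* e :* con (+ 1) := :- (S :* s :* e :* con (+ 1) :* ρ)) refl

  expansionCoeff-suc-suc : ∀ r y m j →
    expansionCoeff r y (suc m) (suc j)
      ≈ expansionCoeff r y m j * fromℕ (r + j) * (y +ᴿ 1#) - expansionCoeff r y m (suc j) * fromℕ (r + suc j)
  expansionCoeff-suc-suc r y m j = begin
    fromℕ ((suc j + r) ℕ.* S₁ + S₀) * pow (- 1#) (suc m + suc j) * fromℕ (rising r j ℕ.* (r + j)) * (y₁ * Y)
      ≈⟨ *-cong (*-cong (*-cong unfoldS sign-step²) unfoldρ) refl ⟩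
    (f * fromℕ S₁ +ᴿ fromℕ S₀) * (- 1# * (- 1# * s)) * (ρ * g) * (y₁ * Y)
      ≈⟨ split f (fromℕ S₁) (fromℕ S₀) s ρ g y₁ Y ⟩
    fromℕ S₀ * s * ρ * Y * g * y₁ - fromℕ S₁ * (- 1# * s) * (ρ * g) * (y₁ * Y) * f
      ≈⟨ +-congˡ (-‿cong (*-congʳ (*-congʳ (*-cong (*-congˡ sign-step) unfoldρ)))) ⟨
    expansionCoeff r y m j * g * y₁ - expansionCoeff r y m (suc j) * f ∎
    where
    S₀ S₁ : ℕ
    S₀ = rStirling r m j
    S₁ = rStirling r m (suc j)
    f g y₁ Y s ρ : Carrier
    f  = fromℕ (r + suc j)
    g  = fromℕ (r + j)
    y₁ = y +ᴿ 1#
    Y  = pow y₁ j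
    s  = pow (- 1#) (m + j)
    ρ  = fromℕ (rising r j)
    sign-step : pow (- 1#) (m + suc j) ≈ - 1# * s
    sign-step = reflexive (≡.cong (pow (- 1#)) (ℕₚ.+-suc m j))
    sign-step² : pow (- 1#) (suc m + suc j) ≈ - 1# * (- 1# * s)
    sign-step² = *-congˡ sign-step
    unfoldS : fromℕ ((suc j + r) ℕ.* S₁ + S₀) ≈ f * fromℕ S₁ +ᴿ fromℕ S₀
    unfoldS = trans (fromℕ-+ ((suc j + r) ℕ.* S₁) S₀) (+-congʳ (trans (fromℕ-* (suc j + r) S₁) (*-congʳ (fromℕ-cong (ℕₚ.+-comm (suc j) r)))))
    unfoldρ : fromℕ (rising r j ℕ.* (r + j)) ≈ ρ * g
    unfoldρ = fromℕ-* (rising r j) (r + j)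
    split : ∀ f S₁ S₀ s ρ g y₁ Y →
      (f * S₁ +ᴿ S₀) * (- 1# * (- 1# * s)) * (ρ * g) * (y₁ * Y)
        ≈ S₀ * s * ρ * Y * g * y₁ - S₁ * (- 1# * s) * (ρ * g) * (y₁ * Y) * f
    split = solve 8 (λ f S₁ S₀ s ρ g y₁ Y →
      (f :* S₁ :+ S₀) :* (:- con (+ 1) :* (:- con (+ 1) :* s)) :* (ρ :* g) :* (y₁ :* Y)
        := S₀ :* s :* ρ :* Y :* g :* y₁ :- S₁ :* (:- con (+ 1) :* s) :* (ρ :* g) :* (y₁ :* Y) :* f) refl

  expansionCoeff-vanishes : ∀ r y m → expansionCoeff r y m (suc m) ≈ 0#
  expansionCoeff-vanishes r y m =
    trans (*-congʳ (*-congʳ (*-congʳ (fromℕ-cong (rStirling-< r (ℕₚ.n<1+n m))))))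
          (solve 3 (λ x y z → con (+ 0) :* x :* y :* z := con (+ 0)) refl _ _ _)

  expansionCoeff-sumTo-suc : ∀ r y m (W : ℕ → Carrier) →
    sumTo m (λ j → expansionCoeff r y m j * (fromℕ (r + j) * (y +ᴿ 1#) * W (suc (r + j)) - fromℕ (r + j) * W (r + j)))
      ≈ sumTo (suc m) (λ j → expansionCoeff r y (suc m) j * W (r + j))
  expansionCoeff-sumTo-suc r y m W = begin
    sumTo m (λ j → c m j * (g j * y₁ * W (suc (r + j)) - g j * W (r + j)))
      ≈⟨ sumTo-cong m (λ j → distribute _ _ _ _ _) ⟩
    sumTo m (λ j → P j - Q j)
      ≈⟨ sumTo-sub m P Q ⟩
    sumTo m P - sumTo m Q
      ≈⟨ +-congˡ (-‿cong (trans (sym (sumTo-dropLast m Q Qₘ₊₁≈0)) (sumTo-sucˡ m Q))) ⟩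
    sumTo m P - (Q 0 +ᴿ sumTo m (λ j → Q (suc j)))
      ≈⟨ regroup _ _ _ ⟩
    - Q 0 +ᴿ (sumTo m P - sumTo m (λ j → Q (suc j)))
      ≈⟨ +-congˡ (sumTo-sub m _ _) ⟨
    - Q 0 +ᴿ sumTo m (λ j → P j - Q (suc j))
      ≈⟨ +-cong head (sumTo-cong m tail) ⟨
    c (suc m) 0 * W (r + 0) +ᴿ sumTo m (λ j → c (suc m) (suc j) * W (r + suc j))
      ≈⟨ sumTo-sucˡ m _ ⟨
    sumTo (suc m) (λ j → c (suc m) j * W (r + j)) ∎
    where
    open import Algebra.Properties.Ring ring using (-‿distribˡ-*; [y-z]x≈yx-zx)
    c : ℕ → ℕ → Carrier
    c = expansionCoeff r y
    y₁ : Carrier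
    y₁ = y +ᴿ 1#
    g P Q : ℕ → Carrier
    g j = fromℕ (r + j)
    P j = c m j * g j * y₁ * W (suc (r + j))
    Q j = c m j * g j * W (r + j)

    Qₘ₊₁≈0 : Q (suc m) ≈ 0#
    Qₘ₊₁≈0 = trans (*-congʳ (*-congʳ (expansionCoeff-vanishes r y m))) (trans (*-congʳ (zeroˡ _)) (zeroˡ _))

    head : c (suc m) 0 * W (r + 0) ≈ - Q 0
    head = trans (*-congʳ (expansionCoeff-suc-zero r y m)) (sym (-‿distribˡ-* _ _))

    tail : ∀ j → c (suc m) (suc j) * W (r + suc j) ≈ P j - Q (suc j)
    tail j = begin
      c (suc m) (suc j) * W (r + suc j)
        ≈⟨ *-congʳ (expansionCoeff-suc-suc r y m j) ⟩
      (c m j * g j * y₁ - c m (suc j) * g (suc j)) * W (r + suc j)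
        ≈⟨ [y-z]x≈yx-zx _ _ _ ⟩
      c m j * g j * y₁ * W (r + suc j) - Q (suc j)
        ≡⟨ ≡.cong (λ s → c m j * g j * y₁ * W s - Q (suc j)) (ℕₚ.+-suc r j) ⟩
      P j - Q (suc j) ∎

    distribute : ∀ c g y₁ W₁ W₀ → c * (g * y₁ * W₁ - g * W₀) ≈ c * g * y₁ * W₁ - c * g * W₀
    distribute = solve 5 (λ c g y₁ W₁ W₀ → c :* (g :* y₁ :* W₁ :- g :* W₀) := c :* g :* y₁ :* W₁ :- c :* g :* W₀) refl
    regroup : ∀ p q₀ q → p - (q₀ +ᴿ q) ≈ - q₀ +ᴿ (p - q)
    regroup = solve 3 (λ p q₀ q → p :- (q₀ :+ q) := :- q₀ :+ (p :- q)) refl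

  w-+-expansion : ∀ r y m n → w (n + m) r y ≈ sumTo m (λ j → expansionCoeff r y m j * w n (r + j) y)
  w-+-expansion r y zero n = begin
    w (n + 0) r y                           ≡⟨ ≡.cong₂ (λ k s → w k s y) (ℕₚ.+-identityʳ n) (≡.sym (ℕₚ.+-identityʳ r)) ⟩
    w n (r + 0) y                           ≈⟨ unit (w n (r + 0) y) ⟨
    expansionCoeff r y 0 0 * w n (r + 0) y  ∎
    where
    unit : ∀ x → (1# +ᴿ 0#) * 1# * (1# +ᴿ 0#) * 1# * x ≈ x
    unit = solve 1 (λ x → (con (+ 1) :+ con (+ 0)) :* con (+ 1) :* (con (+ 1) :+ con (+ 0)) :* con (+ 1) :* x := x) refl
  w-+-expansion r y (suc m) n = begin
    w (n + suc m) r y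
      ≡⟨ ≡.cong (λ k → w k r y) (ℕₚ.+-suc n m) ⟩
    w (suc n + m) r y
      ≈⟨ w-+-expansion r y m (suc n) ⟩
    sumTo m (λ j → expansionCoeff r y m j * w (suc n) (r + j) y)
      ≈⟨ sumTo-cong m (λ j → *-congˡ (w-suc n (r + j) y)) ⟩
    sumTo m (λ j → expansionCoeff r y m j * (fromℕ (r + j) * (y +ᴿ 1#) * W (suc (r + j)) - fromℕ (r + j) * W (r + j)))
      ≈⟨ expansionCoeff-sumTo-suc r y m W ⟩
    sumTo (suc m) (λ j → expansionCoeff r y (suc m) j * W (r + j)) ∎
    where
    W : ℕ → Carrier
    W s = w n s y

corollary3p8 : ∀ {c ℓ} (R : CommutativeRing c ℓ) →
    let open CommutativeRing R renaming (_+_ to _+ᴿ_) in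
    let open WithRing R in
    ∀ (n m r : ℕ) (y : Carrier) →
      w (n + m) r y ≈
        sumTo n (λ k → sumTo m (λ j →
          fromℕ (rStirling r m j) * fromℕ (n C k) * pow (fromℕ (j + r)) (n ∸ k)
            * pow (- 1#) (n + m + j) * fromℕ (rising r j) * pow (y +ᴿ 1#) j
            * w k (r + j) (- y - 1#)))
corollary3p8 R n m r y = begin
  w (n + m) r y                                           ≈⟨ w-+-expansion r y m n ⟩
  sumTo m (λ j → expansionCoeff r y m j * w n (r + j) y)  ≈⟨ sumTo-cong m reflected ⟨
  sumTo m (λ j → sumTo n (λ k → term k j))                ≈⟨ sumTo-comm n m term ⟨
  sumTo n (λ k → sumTo m (λ j → term k j))                ∎
  where
  open CommutativeRing R renaming (_+_ to _+ᴿ_) hiding (zero)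
  open WithRing R
  open RingArithmetic R
  open Sums R
  open BinomialTransform R
  open StirlingPolynomials R
  open import Relation.Binary.Reasoning.Setoid setoid

  term : ℕ → ℕ → Carrier
  term k j = fromℕ (rStirling r m j) * fromℕ (n C k) * pow (fromℕ (j + r)) (n ∸ k)
               * pow (- 1#) (n + m + j) * fromℕ (rising r j) * pow (y +ᴿ 1#) j
               * w k (r + j) (- y - 1#)

  reflected : ∀ j → sumTo n (λ k → term k j) ≈ expansionCoeff r y m j * w n (r + j) y
  reflected j = begin
    sumTo n (λ k → term k j)                            ≈⟨ sumTo-cong n factor ⟩
    sumTo n (λ k → expansionCoeff r y m j * (σ * b k))  ≈⟨ trans (sumTo-*ˡ n _ _) (*-congˡ (sumTo-*ˡ n σ b)) ⟩
    expansionCoeff r y m j * (σ * sumTo n b)            ≈⟨ *-congˡ (w-reflection y n (r + j)) ⟩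
    expansionCoeff r y m j * w n (r + j) y              ∎
    where
    σ : Carrier
    σ = pow (- 1#) n
    b : ℕ → Carrier
    b k = fromℕ (n C k) * pow (fromℕ (r + j)) (n ∸ k) * w k (r + j) (- y - 1#)
    factor : ∀ k → term k j ≈ expansionCoeff r y m j * (σ * b k)
    factor k = trans (*-congʳ (*-congʳ (*-congʳ (*-cong (*-congˡ base-comm) sign-split)))) (reorder _ _ _ _ _ _ _ _)
      where
      base-comm : pow (fromℕ (j + r)) (n ∸ k) ≈ pow (fromℕ (r + j)) (n ∸ k)
      base-comm = reflexive (≡.cong (λ i → pow (fromℕ i) (n ∸ k)) (ℕₚ.+-comm j r))
      sign-split : pow (- 1#) (n + m + j) ≈ σ * pow (- 1#) (m + j)
      sign-split = trans (reflexive (≡.cong (pow (- 1#)) (ℕₚ.+-assoc n m j))) (pow-+ (- 1#) n (m + j))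
      reorder : ∀ S C p σ s ρ Y x → S * C * p * (σ * s) * ρ * Y * x ≈ S * s * ρ * Y * (σ * (C * p * x))
      reorder = solve 8 (λ S C p σ s ρ Y x → S :* C :* p :* (σ :* s) :* ρ :* Y :* x := S :* s :* ρ :* Y :* (σ :* (C :* p :* x))) refl
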